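{- Let $G=(X\,\dot\cup\,Y,E)$ be a finite bipartite graph that admits a matching saturating $X$, and let $W$ be an envy-free matching in $G$. Then $W$ is contained in some matching of $G$ that saturates $X$.
   Context: For a matching $W$, $X_W,Y_W$ denote the vertices of $X,Y$ covered by $W$; $W$ is \emph{envy-free} (with respect to $X$) if no vertex of $X\setminus X_W$ is adjacent to any vertex of $Y_W$. -}

module Defs where

open import Data.Nat using (ℕ)
open import Data.Fin using (Fin)
open import Data.Bool using (Bool; true)
open import Data.Product using (∃; _×_)
open import Relation.Binary.PropositionalEquality using (_≡_)
open import Relation.Nullary using (¬_)

-- A finite bipartite graph G = (X ∪̇ Y, E) with X = Fin m, Y = Fin n.
-- Edges only go between X and Y; E is given by its characteristic
-- function:  x and y are adjacent iff  E x y ≡ true.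
BipGraph : ℕ → ℕ → Set
BipGraph m n = Fin m → Fin n → Bool

EdgeSet : ℕ → ℕ → Set
EdgeSet m n = Fin m → Fin n → Bool

_∋_─_ : ∀ {m n} → EdgeSet m n → Fin m → Fin n → Set
W ∋ x ─ y = W x y ≡ true

IsMatching : ∀ {m n} → BipGraph m n → EdgeSet m n → Set
IsMatching {m} {n} G W =
  (∀ x y → W ∋ x ─ y → G ∋ x ─ y)
  × (∀ x y y′ → W ∋ x ─ y → W ∋ x ─ y′ → y ≡ y′)
  × (∀ x x′ y → W ∋ x ─ y → W ∋ x′ ─ y → x ≡ x′)

CoveredX : ∀ {m n} → EdgeSet m n → Fin m → Set
CoveredX W x = ∃ λ y → W ∋ x ─ y

CoveredY : ∀ {m n} → EdgeSet m n → Fin n → Set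
CoveredY W y = ∃ λ x → W ∋ x ─ y

SaturatesX : ∀ {m n} → EdgeSet m n → Set
SaturatesX W = ∀ x → CoveredX W x

EnvyFree : ∀ {m n} → BipGraph m n → EdgeSet m n → Set
EnvyFree G W = ∀ x y → ¬ CoveredX W x → CoveredY W y → ¬ (G ∋ x ─ y)

_⊆E_ : ∀ {m n} → EdgeSet m n → EdgeSet m n → Set
W ⊆E M = ∀ x y → W ∋ x ─ y → M ∋ x ─ y

module Submission where

-- Let M be a matching saturating X and W an envy-free
-- matching.  Splice the two along X_W: every vertex of X_W keeps its
-- W-edge, every other vertex of X keeps its M-edge.  The result clearly
-- saturates X and contains W.  Two of its edges can only collide in Y if
-- one is a W-edge x ─ y with x ∈ X_W and the other an M-edge x′ ─ y with
-- x′ ∉ X_W; but then x′ ∉ X_W is adjacent to y ∈ Y_W, which envy-freeness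
-- forbids.

open import Defs
open import Data.Nat using (ℕ)
open import Data.Fin using (Fin)
open import Data.Fin.Properties using (any?)
open import Data.Bool using (true; if_then_else_)
open import Data.Bool.Properties using () renaming (_≟_ to _≟ᵇ_)
open import Data.Product using (Σ; ∃; _×_; _,_)
open import Data.Sum using (_⊎_; inj₁; inj₂)
open import Data.Empty using (⊥; ⊥-elim)
open import Level using (0ℓ)
open import Relation.Nullary using (yes; no; does; ¬_; contradiction)
open import Relation.Unary using (Pred; Decidable)
open import Relation.Binary.PropositionalEquality using (_≡_)

coveredX? : ∀ {m n} (W : EdgeSet m n) → Decidable (CoveredX W)
coveredX? W x = any? (λ y → W x y ≟ᵇ true)

module Splice {m n : ℕ} {S : Pred (Fin m) 0ℓ} (S? : Decidable S)
              (W M : EdgeSet m n) where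

  splice : EdgeSet m n
  splice x y = if does (S? x) then W x y else M x y

  splice-edge : ∀ {x y} → splice ∋ x ─ y
              → (S x × W ∋ x ─ y) ⊎ (¬ S x × M ∋ x ─ y)
  splice-edge {x} e with S? x
  ... | yes s = inj₁ (s , e)
  ... | no ¬s = inj₂ (¬s , e)

  splice-fromW : ∀ {x y} → S x → W ∋ x ─ y → splice ∋ x ─ y
  splice-fromW {x} s e with S? x
  ... | yes _  = e
  ... | no ¬s  = contradiction s ¬s

  Separated : Set
  Separated = ∀ x x′ y → S x → ¬ S x′ → W ∋ x ─ y → M ∋ x′ ─ y → ⊥

  splice-matching : ∀ (G : BipGraph m n) → IsMatching G W → IsMatching G M
                  → Separated → IsMatching G splice
  splice-matching G (W⊆G , W-fun , W-inj) (M⊆G , M-fun , M-inj) sep =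
    ⊆G , functional , injective
    where
    ⊆G : ∀ x y → splice ∋ x ─ y → G ∋ x ─ y
    ⊆G x y e with splice-edge e
    ... | inj₁ (_ , w) = W⊆G x y w
    ... | inj₂ (_ , f) = M⊆G x y f

    functional : ∀ x y y′ → splice ∋ x ─ y → splice ∋ x ─ y′ → y ≡ y′
    functional x y y′ e e′ with splice-edge e | splice-edge e′
    ... | inj₁ (_ , w) | inj₁ (_ , w′) = W-fun x y y′ w w′
    ... | inj₂ (_ , f) | inj₂ (_ , f′) = M-fun x y y′ f f′
    ... | inj₁ (s , _) | inj₂ (¬s , _) = contradiction s ¬s
    ... | inj₂ (¬s , _) | inj₁ (s , _) = contradiction s ¬s

    -- The mixed cases are exactly what separation excludes.
    injective : ∀ x x′ y → splice ∋ x ─ y → splice ∋ x′ ─ y → x ≡ x′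
    injective x x′ y e e′ with splice-edge e | splice-edge e′
    ... | inj₁ (_ , w) | inj₁ (_ , w′) = W-inj x x′ y w w′
    ... | inj₂ (_ , f) | inj₂ (_ , f′) = M-inj x x′ y f f′
    ... | inj₁ (s , w) | inj₂ (¬s′ , f′) = ⊥-elim (sep x x′ y s ¬s′ w f′)
    ... | inj₂ (¬s , f) | inj₁ (s′ , w′) = ⊥-elim (sep x′ x y s′ ¬s w′ f)

  splice-saturates : (∀ x → S x → CoveredX W x) → SaturatesX M
                   → SaturatesX splice
  splice-saturates W-covers M-sat x with S? x
  ... | yes s = W-covers x s
  ... | no _  = M-sat x

  splice-contains : (∀ x y → W ∋ x ─ y → S x) → W ⊆E splice
  splice-contains W-in-S x y w = splice-fromW (W-in-S x y w) w

-- For an envy-free W and any M ⊆ G, W and M are separated along X_W: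
-- an M-edge x′ ─ y with x′ ∉ X_W lies in G, so y cannot be in Y_W.
envyFree-separated : ∀ {m n} (G : BipGraph m n) (W M : EdgeSet m n)
                   → EnvyFree G W → (∀ x y → M ∋ x ─ y → G ∋ x ─ y)
                   → Splice.Separated (coveredX? W) W M
envyFree-separated G W M envy-free M⊆G x x′ y _ x′∉X_W w f =
  envy-free x′ y x′∉X_W (x , w) (M⊆G x′ y f)

lemma3p1 : (m n : ℕ) (G : BipGraph m n)
           → (∃ λ M → IsMatching G M × SaturatesX M)
           → (W : EdgeSet m n) → IsMatching G W → EnvyFree G W
           → Σ (EdgeSet m n) λ M → IsMatching G M × SaturatesX M × (W ⊆E M)
lemma3p1 m n G (M , M-matching@(M⊆G , _) , M-sat) W W-matching envy-free =
  splice
  , splice-matching G W-matching M-matching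
      (envyFree-separated G W M envy-free M⊆G)
  , splice-saturates (λ _ covered → covered) M-sat
  , splice-contains (λ x y w → y , w)
  where
  open Splice (coveredX? W) W M
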